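{- Let $n\ge 4$ and let $\mathbf P=(P_{ij})_{0\le i,j\le n-1}$ be the $n\times n$ transition probability matrix with entries $P_{00}=5/6,\ P_{01}=1/6$; $P_{10}=5/6,\ P_{12}=1/6$; for $2\le i\le n-3$: $P_{i0}=2/3,\ P_{i,i-1}=P_{i,i+1}=1/6$; $P_{n-2,0}=16/21,\ P_{n-2,n-3}=1/6,\ P_{n-2,n-1}=1/14$; $P_{n-1,0}=1/3,\ P_{n-1,n-2}=1/6,\ P_{n-1,n-1}=1/2$; and all other entries $0$. Then the steady state probability vector $\vec\pi=(\pi_0,\dots,\pi_{n-1})$ of $\mathbf P$ is given by $$\pi_i=\frac{c_{n-1-i}}{\sum_{j=0}^{n-1}c_j},\qquad i=0,1,\dots,n-1.$$
   Context: The Lucas-cobalancing numbers $c_m$ are defined by $c_0=1$, $c_1=7$, $c_{m+1}=6c_m-c_{m-1}$ (so $c_2=41$, $c_3=239,\dots$). The steady state probability vector of a transition probability matrix $\mathbf P$ is the probability row vector $\vec\pi$ (nonnegative entries summing to $1$) satisfying $\vec\pi=\vec\pi\mathbf P$. -}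

module Defs where

open import Data.Nat as ℕ using (ℕ; zero; suc; _∸_; _≡ᵇ_; _≤ᵇ_)
open import Data.Integer as ℤ using (ℤ; +_)
open import Data.Rational as ℚ using (ℚ; 0ℚ; 1ℚ; _≟_; _÷_; ≢-nonZero)
open import Data.Fin using (Fin; toℕ)
import Data.Fin as Fin
open import Data.Bool using (Bool; if_then_else_; _∧_)
open import Relation.Nullary using (yes; no)
open import Relation.Binary.PropositionalEquality using (_≡_)

-- Lucas-cobalancing numbers: c 0 = 1, c 1 = 7, c (m+2) = 6 c (m+1) - c m  (in ℤ)
c : ℕ → ℤ
c zero = + 1
c (suc zero) = + 7
c (suc (suc m)) = (+ 6) ℤ.* c (suc m) ℤ.- c m

cℚ : ℕ → ℚ
cℚ m = c m ℚ./ 1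

sumFin : (n : ℕ) → (Fin n → ℚ) → ℚ
sumFin zero f = 0ℚ
sumFin (suc n) f = f Fin.zero ℚ.+ sumFin n (λ i → f (Fin.suc i))


sumℕ : ℕ → (ℕ → ℚ) → ℚ
sumℕ zero f = 0ℚ
sumℕ (suc n) f = sumℕ n f ℚ.+ f n

-- total division (division by 0 returns 0); only ever used with a nonzero divisor here
_÷'_ : ℚ → ℚ → ℚ
p ÷' q with q ≟ 0ℚ
... | yes _ = 0ℚ
... | no q≢0 = _÷_ p q {{≢-nonZero q≢0}}

Pℕ : ℕ → ℕ → ℕ → ℚ
Pℕ n i j =
  if i ≡ᵇ 0 then
    (if j ≡ᵇ 0 then + 5 ℚ./ 6 else if j ≡ᵇ 1 then + 1 ℚ./ 6 else 0ℚ)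
  else if i ≡ᵇ 1 then
    (if j ≡ᵇ 0 then + 5 ℚ./ 6 else if j ≡ᵇ 2 then + 1 ℚ./ 6 else 0ℚ)
  else if i ≡ᵇ (n ∸ 2) then
    (if j ≡ᵇ 0 then + 16 ℚ./ 21 else if j ≡ᵇ (n ∸ 3) then + 1 ℚ./ 6
     else if j ≡ᵇ (n ∸ 1) then + 1 ℚ./ 14 else 0ℚ)
  else if i ≡ᵇ (n ∸ 1) then
    (if j ≡ᵇ 0 then + 1 ℚ./ 3 else if j ≡ᵇ (n ∸ 2) then + 1 ℚ./ 6
     else if j ≡ᵇ (n ∸ 1) then + 1 ℚ./ 2 else 0ℚ)
  else
    (if j ≡ᵇ 0 then + 2 ℚ./ 3 else if j ≡ᵇ (i ∸ 1) then + 1 ℚ./ 6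
     else if j ≡ᵇ suc i then + 1 ℚ./ 6 else 0ℚ)

P : (n : ℕ) → Fin n → Fin n → ℚ
P n i j = Pℕ n (toℕ i) (toℕ j)

record IsSteadyState (n : ℕ) (M : Fin n → Fin n → ℚ) (π : Fin n → ℚ) : Set where
  field
    nonneg    : ∀ i → 0ℚ ℚ.≤ π i
    sums-to-1 : sumFin n π ≡ 1ℚ
    stationary : ∀ j → π j ≡ sumFin n (λ i → π i ℚ.* M i j)

{-# OPTIONS --safe #-}
-- Columns 1, …, n−1 of π = πP only involve neighbouring entries: column n−1 says
-- π_{n−2} = 7 π_{n−1} = c₁ π_{n−1}, and column j says π_{j−1} = 6 π_j − π_{j+1}, the
-- recurrence of the c_m read from the top. Hence π_i = c_{n−1−i} π_{n−1}, and normalisation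
-- forces π_{n−1} = 1 / Σ c_j. Conversely, this vector is nonnegative, sums to 1 and satisfies
-- those columns; column 0 then reduces to the summation identity
-- 4 (c₀ + ⋯ + c_K) = c_{K+1} − c_K − 2.

module Submission where

open import Defs
open import Algebra.Bundles using (CommutativeMonoid)
open import Data.Bool using (true; false; if_then_else_)
open import Data.Bool.Properties using (T-≡; ¬-not)
open import Data.Empty using (⊥-elim)
open import Data.Fin using (Fin; toℕ; fromℕ<)
import Data.Fin as Fin
open import Data.Fin.Properties using (toℕ<n; toℕ-fromℕ<; fromℕ<-toℕ)
open import Data.Integer as ℤ using (ℤ)
import Data.Integer.Properties as ℤP
open import Data.Integer.Tactic.RingSolver using (solve-∀)
open import Data.Nat as ℕ using (ℕ; zero; suc; _≤_; _<_; _∸_; _≡ᵇ_; z≤n; s≤s)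
import Data.Nat.Properties as ℕP
open import Data.Product using (_×_; _,_; proj₁; proj₂)
open import Data.Rational as ℚ
  using (ℚ; 0ℚ; 1ℚ; ½; _+_; _*_; _-_; _/_; 1/_; _≟_; NonNegative; Positive; ≢-nonZero)
import Data.Rational.Properties as ℚP
import Data.Rational.Unnormalised as ℚᵘ
import Data.Rational.Unnormalised.Properties as ℚᵘP
open import Data.Rational.Solver using (module +-*-Solver)
open import Data.Sum using (inj₁; inj₂)
open import Function.Base using (case_of_)
open import Function.Bundles using (_⇔_; mk⇔; Equivalence)
open import Relation.Binary using (tri<; tri≈; tri>)
open import Relation.Binary.PropositionalEquality
open import Relation.Nullary using (yes; no)

open import Algebra.Properties.CommutativeSemigroup
  (CommutativeMonoid.commutativeSemigroup ℚP.+-0-commutativeMonoid) using (interchange)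
open +-*-Solver

-- Finite sums

sumℕ-cong : ∀ n {f g : ℕ → ℚ} → (∀ i → i < n → f i ≡ g i) → sumℕ n f ≡ sumℕ n g
sumℕ-cong zero    eq = refl
sumℕ-cong (suc n) eq =
  cong₂ _+_ (sumℕ-cong n (λ i i<n → eq i (ℕP.m<n⇒m<1+n i<n))) (eq n (ℕP.n<1+n n))

sumℕ-+ : ∀ n (f g : ℕ → ℚ) → sumℕ n (λ i → f i + g i) ≡ sumℕ n f + sumℕ n g
sumℕ-+ zero    f g = refl
sumℕ-+ (suc n) f g =
  trans (cong (_+ (f n + g n)) (sumℕ-+ n f g)) (interchange (sumℕ n f) (sumℕ n g) (f n) (g n))

sumℕ-*ʳ : ∀ n (f : ℕ → ℚ) x → sumℕ n (λ i → f i * x) ≡ sumℕ n f * x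
sumℕ-*ʳ zero    f x = sym (ℚP.*-zeroˡ x)
sumℕ-*ʳ (suc n) f x =
  trans (cong (_+ f n * x) (sumℕ-*ʳ n f x)) (sym (ℚP.*-distribʳ-+ x (sumℕ n f) (f n)))

sumℕ-zero : ∀ n (f : ℕ → ℚ) → (∀ i → i < n → f i ≡ 0ℚ) → sumℕ n f ≡ 0ℚ
sumℕ-zero zero    f eq = refl
sumℕ-zero (suc n) f eq =
  cong₂ _+_ (sumℕ-zero n f (λ i i<n → eq i (ℕP.m<n⇒m<1+n i<n))) (eq n (ℕP.n<1+n n))

sumℕ-suc : ∀ n (f : ℕ → ℚ) → sumℕ (suc n) f ≡ f 0 + sumℕ n (λ i → f (suc i))
sumℕ-suc zero    f = ℚP.+-comm 0ℚ (f 0)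
sumℕ-suc (suc n) f = trans (cong (_+ f (suc n)) (sumℕ-suc n f)) (ℚP.+-assoc (f 0) _ _)

sumℕ-reverse : ∀ n (f : ℕ → ℚ) → sumℕ n (λ i → f (n ∸ 1 ∸ i)) ≡ sumℕ n f
sumℕ-reverse zero    f = refl
sumℕ-reverse (suc n) f = begin
  sumℕ (suc n) (λ i → f (n ∸ i))      ≡⟨ sumℕ-suc n (λ i → f (n ∸ i)) ⟩
  f n + sumℕ n (λ i → f (n ∸ suc i))  ≡⟨ cong (f n +_) (sumℕ-cong n (λ i _ → cong f (n∸1+i i))) ⟩
  f n + sumℕ n (λ i → f (n ∸ 1 ∸ i))  ≡⟨ cong (f n +_) (sumℕ-reverse n f) ⟩
  f n + sumℕ n f                      ≡⟨ ℚP.+-comm (f n) _ ⟩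
  sumℕ n f + f n                      ∎
  where
  open ≡-Reasoning
  n∸1+i : ∀ i → n ∸ suc i ≡ n ∸ 1 ∸ i
  n∸1+i i = sym (ℕP.∸-+-assoc n 1 i)

sumFin-cong : ∀ n {f g : Fin n → ℚ} → (∀ i → f i ≡ g i) → sumFin n f ≡ sumFin n g
sumFin-cong zero    eq = refl
sumFin-cong (suc n) eq = cong₂ _+_ (eq Fin.zero) (sumFin-cong n (λ i → eq (Fin.suc i)))

sumFin-toℕ : ∀ n (f : ℕ → ℚ) → sumFin n (λ i → f (toℕ i)) ≡ sumℕ n f
sumFin-toℕ zero    f = refl
sumFin-toℕ (suc n) f =
  trans (cong (f 0 +_) (sumFin-toℕ n (λ i → f (suc i)))) (sym (sumℕ-suc n f))

δ : ℕ → ℚ → ℕ → ℚ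
δ a x i = if i ≡ᵇ a then x else 0ℚ

≡ᵇ-refl : ∀ a → (a ≡ᵇ a) ≡ true
≡ᵇ-refl a = Equivalence.to T-≡ (ℕP.≡⇒≡ᵇ a a refl)

≢⇒≡ᵇ-false : ∀ {a b} → a ≢ b → (a ≡ᵇ b) ≡ false
≢⇒≡ᵇ-false {a} {b} a≢b = ¬-not (λ e → a≢b (ℕP.≡ᵇ⇒≡ a b (Equivalence.from T-≡ e)))

<⇒≡ᵇ-false : ∀ {a b} → a < b → (a ≡ᵇ b) ≡ false
<⇒≡ᵇ-false a<b = ≢⇒≡ᵇ-false (ℕP.<⇒≢ a<b)

>⇒≡ᵇ-false : ∀ {a b} → b < a → (a ≡ᵇ b) ≡ false
>⇒≡ᵇ-false b<a = ≢⇒≡ᵇ-false (ℕP.>⇒≢ b<a)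

*-δ : ∀ (f : ℕ → ℚ) a x i → f i * δ a x i ≡ δ a (f a * x) i
*-δ f a x i with i ≡ᵇ a in eq
... | true  = cong (λ k → f k * x) (ℕP.≡ᵇ⇒≡ i a (Equivalence.from T-≡ eq))
... | false = ℚP.*-zeroʳ (f i)

sumℕ-δ : ∀ n a x → a < n → sumℕ n (δ a x) ≡ x
sumℕ-δ (suc n) a x a<1+n with ℕP.<-cmp a n
... | tri< a<n _ _ = begin
  sumℕ n (δ a x) + δ a x n  ≡⟨ cong₂ _+_ (sumℕ-δ n a x a<n) (cong (if_then x else 0ℚ) (>⇒≡ᵇ-false a<n)) ⟩
  x + 0ℚ                    ≡⟨ ℚP.+-identityʳ x ⟩
  x                         ∎
  where open ≡-Reasoning
... | tri≈ _ refl _ = begin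
  sumℕ n (δ n x) + δ n x n  ≡⟨ cong₂ _+_ (sumℕ-zero n (δ n x) (λ i i<n → cong (if_then x else 0ℚ) (<⇒≡ᵇ-false i<n)))
                                         (cong (if_then x else 0ℚ) (≡ᵇ-refl n)) ⟩
  0ℚ + x                    ≡⟨ ℚP.+-identityˡ x ⟩
  x                         ∎
  where open ≡-Reasoning
... | tri> _ _ n<a = ⊥-elim (ℕP.≤⇒≯ (ℕP.≤-pred a<1+n) n<a)

sumℕ-*-δ+δ : ∀ n (f g : ℕ → ℚ) a b x y → a < n → b < n →
             (∀ i → i < n → g i ≡ δ a x i + δ b y i) →
             sumℕ n (λ i → f i * g i) ≡ f a * x + f b * y
sumℕ-*-δ+δ n f g a b x y a<n b<n g≡ = begin
  sumℕ n (λ i → f i * g i)                          ≡⟨ sumℕ-cong n split ⟩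
  sumℕ n (λ i → δ a (f a * x) i + δ b (f b * y) i)  ≡⟨ sumℕ-+ n _ _ ⟩
  sumℕ n (δ a (f a * x)) + sumℕ n (δ b (f b * y))   ≡⟨ cong₂ _+_ (sumℕ-δ n a _ a<n) (sumℕ-δ n b _ b<n) ⟩
  f a * x + f b * y                                 ∎
  where
  open ≡-Reasoning
  split : ∀ i → i < n → f i * g i ≡ δ a (f a * x) i + δ b (f b * y) i
  split i i<n = begin
    f i * g i                             ≡⟨ cong (f i *_) (g≡ i i<n) ⟩
    f i * (δ a x i + δ b y i)             ≡⟨ ℚP.*-distribˡ-+ (f i) _ _ ⟩
    f i * δ a x i + f i * δ b y i         ≡⟨ cong₂ _+_ (*-δ f a x i) (*-δ f b y i) ⟩
    δ a (f a * x) i + δ b (f b * y) i     ∎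

vecMulP : ℕ → (ℕ → ℚ) → ℕ → ℚ
vecMulP n f j = sumℕ n (λ i → f i * Pℕ n i j)

sumFin-*P≡vecMulP : ∀ n (π : Fin n → ℚ) (f : ℕ → ℚ) → (∀ i → π i ≡ f (toℕ i)) →
                    ∀ j → sumFin n (λ i → π i * P n i j) ≡ vecMulP n f (toℕ j)
sumFin-*P≡vecMulP n π f π≡f j =
  trans (sumFin-cong n (λ i → cong (_* P n i j) (π≡f i))) (sumFin-toℕ n (λ i → f i * Pℕ n i (toℕ j)))

extend : (n : ℕ) → (Fin n → ℚ) → ℕ → ℚ
extend n π i with i ℕP.<? n
... | yes i<n = π (fromℕ< i<n)
... | no  _   = 0ℚ

extend-toℕ : ∀ n π (i : Fin n) → π i ≡ extend n π (toℕ i)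
extend-toℕ n π i with toℕ i ℕP.<? n
... | yes i<n  = cong π (sym (fromℕ<-toℕ i i<n))
... | no  i≮n  = ⊥-elim (i≮n (toℕ<n i))

extend-fromℕ< : ∀ n π j (j<n : j < n) → extend n π j ≡ π (fromℕ< j<n)
extend-fromℕ< n π j j<n =
  trans (cong (extend n π) (sym (toℕ-fromℕ< j<n))) (sym (extend-toℕ n π (fromℕ< j<n)))

-- The columns of P

⅙ ⅔ -⅓ ¹⁄₁₄ ²⁄₂₁ 2ℚ 4ℚ 6ℚ : ℚ
⅙   = ℤ.+ 1 / 6
⅔   = ℤ.+ 2 / 3
-⅓  = ℤ.-[1+ 0 ] / 3
¹⁄₁₄ = ℤ.+ 1 / 14
²⁄₂₁ = ℤ.+ 2 / 21
2ℚ = ℤ.+ 2 / 1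
4ℚ = ℤ.+ 4 / 1
6ℚ = ℤ.+ 6 / 1

P-row-interior : ∀ m k j → k < m → Pℕ (4 ℕ.+ m) (2 ℕ.+ k) j ≡
  (if j ≡ᵇ 0 then ⅔ else if j ≡ᵇ suc k then ⅙ else if j ≡ᵇ 3 ℕ.+ k then ⅙ else 0ℚ)
P-row-interior m k j k<m rewrite <⇒≡ᵇ-false k<m | <⇒≡ᵇ-false (ℕP.m<n⇒m<1+n k<m) = refl

P-row-penult : ∀ m j → Pℕ (4 ℕ.+ m) (2 ℕ.+ m) j ≡
  (if j ≡ᵇ 0 then ℤ.+ 16 / 21 else if j ≡ᵇ suc m then ⅙ else if j ≡ᵇ 3 ℕ.+ m then ¹⁄₁₄ else 0ℚ)
P-row-penult m j rewrite ≡ᵇ-refl m = refl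

P-row-last : ∀ m j → Pℕ (4 ℕ.+ m) (3 ℕ.+ m) j ≡
  (if j ≡ᵇ 0 then ℤ.+ 1 / 3 else if j ≡ᵇ 2 ℕ.+ m then ⅙ else if j ≡ᵇ 3 ℕ.+ m then ½ else 0ℚ)
P-row-last m j rewrite >⇒≡ᵇ-false (ℕP.n<1+n m) | ≡ᵇ-refl m = refl

data RowIndex (m : ℕ) : ℕ → Set where
  first    : RowIndex m 0
  second   : RowIndex m 1
  interior : ∀ k → k < m → RowIndex m (2 ℕ.+ k)
  penult   : RowIndex m (2 ℕ.+ m)
  last     : RowIndex m (3 ℕ.+ m)

rowIndex : ∀ m i → i < 4 ℕ.+ m → RowIndex m i
rowIndex m zero                _ = first
rowIndex m (suc zero)          _ = second
rowIndex m (suc (suc k)) (s≤s (s≤s k<2+m)) with ℕP.<-cmp k m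
... | tri< k<m _ _ = interior k k<m
... | tri≈ _ refl _ = penult
... | tri> _ _ m<k with ℕP.≤-antisym (ℕP.≤-pred k<2+m) m<k
...   | refl = last

≡ᵇ-sym : ∀ a b → (a ≡ᵇ b) ≡ (b ≡ᵇ a)
≡ᵇ-sym zero    zero    = refl
≡ᵇ-sym zero    (suc b) = refl
≡ᵇ-sym (suc a) zero    = refl
≡ᵇ-sym (suc a) (suc b) = ≡ᵇ-sym a b

neighbours≡δ+δ : ∀ a b → (if a ≡ᵇ b then ⅙ else if a ≡ᵇ 2 ℕ.+ b then ⅙ else 0ℚ) ≡
                         δ a ⅙ (2 ℕ.+ b) + δ (2 ℕ.+ a) ⅙ (2 ℕ.+ b)
neighbours≡δ+δ zero                zero    = refl
neighbours≡δ+δ zero                (suc b) = refl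
neighbours≡δ+δ (suc zero)          zero    = refl
neighbours≡δ+δ (suc (suc zero))    zero    = refl
neighbours≡δ+δ (suc (suc (suc a))) zero    = refl
neighbours≡δ+δ (suc a)             (suc b) = neighbours≡δ+δ a b

P-column-zero : ∀ m i → i < 4 ℕ.+ m →
  Pℕ (4 ℕ.+ m) i 0 ≡ ⅔ + ((δ 0 ⅙ i + δ 1 ⅙ i) + (δ (2 ℕ.+ m) ²⁄₂₁ i + δ (3 ℕ.+ m) -⅓ i))
P-column-zero m i i<n with rowIndex m i i<n
... | first  = refl
... | second = refl
... | interior k k<m rewrite P-row-interior m k 0 k<m | <⇒≡ᵇ-false k<m | <⇒≡ᵇ-false (ℕP.m<n⇒m<1+n k<m) = refl
... | penult rewrite P-row-penult m 0 | ≡ᵇ-refl m | <⇒≡ᵇ-false (ℕP.n<1+n m) = refl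
... | last   rewrite P-row-last m 0 | >⇒≡ᵇ-false (ℕP.n<1+n m) | ≡ᵇ-refl m = refl

P-column-below : ∀ m {j i} → j ≤ m → RowIndex m i → Pℕ (4 ℕ.+ m) i (suc j) ≡ δ j ⅙ i + δ (2 ℕ.+ j) ⅙ i
P-column-below m {zero}        _ first  = refl
P-column-below m {suc j}       _ first  = refl
P-column-below m {zero}        _ second = refl
P-column-below m {suc zero}    _ second = refl
P-column-below m {suc (suc j)} _ second = refl
P-column-below m {j} _ (interior k k<m) rewrite P-row-interior m k (suc j) k<m = neighbours≡δ+δ j k
P-column-below m {j} j≤m penult
  rewrite P-row-penult m (suc j) | <⇒≡ᵇ-false (s≤s (ℕP.m<n⇒m<1+n (s≤s j≤m)))
        | >⇒≡ᵇ-false (ℕP.m<n⇒m<1+n (s≤s j≤m)) | ≡ᵇ-sym m j with j ≡ᵇ m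
... | true  = refl
... | false = refl
P-column-below m {j} j≤m last
  rewrite P-row-last m (suc j) | <⇒≡ᵇ-false (s≤s j≤m) | <⇒≡ᵇ-false (ℕP.m<n⇒m<1+n (s≤s j≤m))
        | >⇒≡ᵇ-false (ℕP.m<n⇒m<1+n (ℕP.m<n⇒m<1+n (s≤s j≤m))) | >⇒≡ᵇ-false (s≤s j≤m) = refl

P-column-penult : ∀ m {i} → RowIndex m i → Pℕ (4 ℕ.+ m) i (2 ℕ.+ m) ≡ δ (suc m) ⅙ i + δ (3 ℕ.+ m) ⅙ i
P-column-penult m       first  = refl
P-column-penult zero    second = refl
P-column-penult (suc m) second = refl
P-column-penult m (interior k k<m)
  rewrite P-row-interior m k (2 ℕ.+ m) k<m | >⇒≡ᵇ-false (ℕP.m<n⇒m<1+n k<m) | <⇒≡ᵇ-false (ℕP.m<n⇒m<1+n k<m)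
        | ≡ᵇ-sym m (suc k) with suc k ≡ᵇ m
... | true  = refl
... | false = refl
P-column-penult m penult rewrite P-row-penult m (2 ℕ.+ m) | >⇒≡ᵇ-false (ℕP.n<1+n m) | <⇒≡ᵇ-false (ℕP.n<1+n m) = refl
P-column-penult m last rewrite P-row-last m (2 ℕ.+ m) | >⇒≡ᵇ-false (ℕP.m<n⇒m<1+n (ℕP.n<1+n m)) | ≡ᵇ-refl m = refl

P-column-interior : ∀ m j i → j ≤ suc m → i < 4 ℕ.+ m → Pℕ (4 ℕ.+ m) i (suc j) ≡ δ j ⅙ i + δ (2 ℕ.+ j) ⅙ i
P-column-interior m j i j≤1+m i<n with ℕP.m≤n⇒m<n∨m≡n j≤1+m
... | inj₁ (s≤s j≤m) = P-column-below m j≤m (rowIndex m i i<n)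
... | inj₂ refl      = P-column-penult m (rowIndex m i i<n)

P-column-last : ∀ m i → i < 4 ℕ.+ m → Pℕ (4 ℕ.+ m) i (3 ℕ.+ m) ≡ δ (2 ℕ.+ m) ¹⁄₁₄ i + δ (3 ℕ.+ m) ½ i
P-column-last m i i<n with rowIndex m i i<n
... | first  = refl
... | second = refl
... | interior k k<m
  rewrite P-row-interior m k (3 ℕ.+ m) k<m | >⇒≡ᵇ-false (ℕP.m<n⇒m<1+n (ℕP.m<n⇒m<1+n k<m))
        | >⇒≡ᵇ-false k<m | <⇒≡ᵇ-false k<m | <⇒≡ᵇ-false (ℕP.m<n⇒m<1+n k<m) = refl
... | penult
  rewrite P-row-penult m (3 ℕ.+ m) | >⇒≡ᵇ-false (ℕP.m<n⇒m<1+n (ℕP.n<1+n m)) | ≡ᵇ-refl m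
        | <⇒≡ᵇ-false (ℕP.n<1+n m) = refl
... | last rewrite P-row-last m (3 ℕ.+ m) | >⇒≡ᵇ-false (ℕP.n<1+n m) | ≡ᵇ-refl m = refl

module _ (m : ℕ) (f : ℕ → ℚ) where

  vecMulP-last : vecMulP (4 ℕ.+ m) f (3 ℕ.+ m) ≡ f (2 ℕ.+ m) * ¹⁄₁₄ + f (3 ℕ.+ m) * ½
  vecMulP-last = sumℕ-*-δ+δ (4 ℕ.+ m) f _ _ _ _ _ (ℕP.m<n⇒m<1+n (ℕP.n<1+n _)) (ℕP.n<1+n _) (P-column-last m)

  vecMulP-interior : ∀ j → j ≤ suc m → vecMulP (4 ℕ.+ m) f (suc j) ≡ f j * ⅙ + f (2 ℕ.+ j) * ⅙
  vecMulP-interior j j≤1+m =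
    sumℕ-*-δ+δ (4 ℕ.+ m) f _ _ _ _ _ (ℕP.m≤n⇒m≤1+n (ℕP.m≤n⇒m≤1+n (s≤s j≤1+m))) (s≤s (s≤s (s≤s j≤1+m)))
      (λ i → P-column-interior m j i j≤1+m)

  vecMulP-zero : vecMulP (4 ℕ.+ m) f 0 ≡
    sumℕ (4 ℕ.+ m) f * ⅔ + ((f 0 * ⅙ + f 1 * ⅙) + (f (2 ℕ.+ m) * ²⁄₂₁ + f (3 ℕ.+ m) * -⅓))
  vecMulP-zero = begin
    sumℕ n (λ i → f i * Pℕ n i 0)
      ≡⟨ sumℕ-cong n expand ⟩
    sumℕ n (λ i → f i * ⅔ + (f i * firstRows i + f i * lastRows i))
      ≡⟨ trans (sumℕ-+ n _ _) (cong₂ _+_ (sumℕ-*ʳ n f ⅔) (sumℕ-+ n _ _)) ⟩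
    sumℕ n f * ⅔ + (sumℕ n (λ i → f i * firstRows i) + sumℕ n (λ i → f i * lastRows i))
      ≡⟨ cong (sumℕ n f * ⅔ +_) (cong₂ _+_
           (sumℕ-*-δ+δ n f firstRows 0 1 ⅙ ⅙ (s≤s z≤n) (s≤s (s≤s z≤n)) (λ _ _ → refl))
           (sumℕ-*-δ+δ n f lastRows (2 ℕ.+ m) (3 ℕ.+ m) _ _ (ℕP.m<n⇒m<1+n (ℕP.n<1+n _)) (ℕP.n<1+n _) (λ _ _ → refl))) ⟩
    sumℕ n f * ⅔ + ((f 0 * ⅙ + f 1 * ⅙) + (f (2 ℕ.+ m) * ²⁄₂₁ + f (3 ℕ.+ m) * -⅓)) ∎
    where
    open ≡-Reasoning
    n : ℕ
    n = 4 ℕ.+ m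
    firstRows lastRows : ℕ → ℚ
    firstRows   i = δ 0 ⅙ i + δ 1 ⅙ i
    lastRows i = δ (2 ℕ.+ m) ²⁄₂₁ i + δ (3 ℕ.+ m) -⅓ i
    expand : ∀ i → i < n → f i * Pℕ n i 0 ≡ f i * ⅔ + (f i * firstRows i + f i * lastRows i)
    expand i i<n = begin
      f i * Pℕ n i 0                                    ≡⟨ cong (f i *_) (P-column-zero m i i<n) ⟩
      f i * (⅔ + (firstRows i + lastRows i))            ≡⟨ ℚP.*-distribˡ-+ (f i) _ _ ⟩
      f i * ⅔ + f i * (firstRows i + lastRows i)        ≡⟨ cong (f i * ⅔ +_) (ℚP.*-distribˡ-+ (f i) _ _) ⟩
      f i * ⅔ + (f i * firstRows i + f i * lastRows i)  ∎

-- Lucas-cobalancing numbers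

-- ℚ's _/_ normalises, so integer identities are transported through the unnormalised rationals.
/1-embedding : ∀ a → ℚ.toℚᵘ (a / 1) ℚᵘ.≃ ℚᵘ.mkℚᵘ a 0
/1-embedding a = ℚP.toℚᵘ-fromℚᵘ (ℚᵘ.mkℚᵘ a 0)

[6a-b]/1≡6*a/1-b/1 : ∀ a b → (ℤ.+ 6 ℤ.* a ℤ.- b) / 1 ≡ 6ℚ * (a / 1) - b / 1
[6a-b]/1≡6*a/1-b/1 a b = ℚP.toℚᵘ-injective (begin
  ℚ.toℚᵘ ((ℤ.+ 6 ℤ.* a ℤ.- b) / 1)                     ≈⟨ /1-embedding (ℤ.+ 6 ℤ.* a ℤ.- b) ⟩
  ℚᵘ.mkℚᵘ (ℤ.+ 6 ℤ.* a ℤ.- b) 0                        ≈⟨ integral ⟨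
  ℚᵘ.mkℚᵘ (ℤ.+ 6) 0 ℚᵘ.* ℚᵘ.mkℚᵘ a 0 ℚᵘ.- ℚᵘ.mkℚᵘ b 0
    ≈⟨ ℚᵘP.+-cong (ℚᵘP.*-cong (/1-embedding (ℤ.+ 6)) (/1-embedding a)) (ℚᵘP.-‿cong (/1-embedding b)) ⟨
  ℚ.toℚᵘ 6ℚ ℚᵘ.* ℚ.toℚᵘ (a / 1) ℚᵘ.- ℚ.toℚᵘ (b / 1)
    ≈⟨ ℚᵘP.+-cong (ℚP.toℚᵘ-homo-* 6ℚ (a / 1)) (ℚP.toℚᵘ-homo‿- (b / 1)) ⟨
  ℚ.toℚᵘ (6ℚ * (a / 1)) ℚᵘ.+ ℚ.toℚᵘ (ℚ.- (b / 1))      ≈⟨ ℚP.toℚᵘ-homo-+ (6ℚ * (a / 1)) (ℚ.- (b / 1)) ⟨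
  ℚ.toℚᵘ (6ℚ * (a / 1) - b / 1)                        ∎)
  where
  open ℚᵘP.≃-Reasoning
  integral : ℚᵘ.mkℚᵘ (ℤ.+ 6) 0 ℚᵘ.* ℚᵘ.mkℚᵘ a 0 ℚᵘ.- ℚᵘ.mkℚᵘ b 0 ℚᵘ.≃ ℚᵘ.mkℚᵘ (ℤ.+ 6 ℤ.* a ℤ.- b) 0
  integral = ℚᵘ.*≡* (identity a b)
    where
    identity : ∀ a b → (ℤ.+ 6 ℤ.* a ℤ.* ℤ.+ 1 ℤ.+ ℤ.- b ℤ.* ℤ.+ 1) ℤ.* ℤ.+ 1 ≡ (ℤ.+ 6 ℤ.* a ℤ.- b) ℤ.* ℤ.+ 1
    identity = solve-∀

cℚ-rec : ∀ k → cℚ (2 ℕ.+ k) ≡ 6ℚ * cℚ (suc k) - cℚ k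
cℚ-rec k = [6a-b]/1≡6*a/1-b/1 (c (suc k)) (c k)

cℚ-rec-*ʳ : ∀ k r → cℚ (2 ℕ.+ k) * r ≡ 6ℚ * (cℚ (suc k) * r) - cℚ k * r
cℚ-rec-*ʳ k r = begin
  cℚ (2 ℕ.+ k) * r                    ≡⟨ cong (_* r) (cℚ-rec k) ⟩
  (6ℚ * cℚ (suc k) - cℚ k) * r        ≡⟨ solve 3 (λ a b r → (con 6ℚ :* a :- b) :* r := con 6ℚ :* (a :* r) :- b :* r)
                                           refl (cℚ (suc k)) (cℚ k) r ⟩
  6ℚ * (cℚ (suc k) * r) - cℚ k * r    ∎
  where open ≡-Reasoning

4*sumℕ-cℚ : ∀ k → 4ℚ * sumℕ (suc k) cℚ ≡ cℚ (suc k) - cℚ k - 2ℚ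
4*sumℕ-cℚ zero    = refl
4*sumℕ-cℚ (suc k) = begin
  4ℚ * (sumℕ (suc k) cℚ + cℚ (suc k))         ≡⟨ ℚP.*-distribˡ-+ 4ℚ (sumℕ (suc k) cℚ) (cℚ (suc k)) ⟩
  4ℚ * sumℕ (suc k) cℚ + 4ℚ * cℚ (suc k)      ≡⟨ cong (_+ 4ℚ * cℚ (suc k)) (4*sumℕ-cℚ k) ⟩
  cℚ (suc k) - cℚ k - 2ℚ + 4ℚ * cℚ (suc k)    ≡⟨ solve 2 (λ a b → a :- b :- con 2ℚ :+ con 4ℚ :* a := con 6ℚ :* a :- b :- a :- con 2ℚ)
                                                    refl (cℚ (suc k)) (cℚ k) ⟩
  6ℚ * cℚ (suc k) - cℚ k - cℚ (suc k) - 2ℚ    ≡⟨ cong (λ z → z - cℚ (suc k) - 2ℚ) (cℚ-rec k) ⟨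
  cℚ (2 ℕ.+ k) - cℚ (suc k) - 2ℚ              ∎
  where open ≡-Reasoning

-- The truncated subtraction never truncates, because cℕ is nondecreasing.
cℕ : ℕ → ℕ
cℕ zero             = 1
cℕ (suc zero)       = 7
cℕ (suc (suc k))    = 6 ℕ.* cℕ (suc k) ∸ cℕ k

cℕ-positive-nondecreasing : ∀ k → 1 ≤ cℕ k × cℕ k ≤ cℕ (suc k)
cℕ-positive-nondecreasing zero    = s≤s z≤n , s≤s z≤n
cℕ-positive-nondecreasing (suc k) with cℕ-positive-nondecreasing k
... | 1≤b , b≤a = ℕP.≤-trans 1≤b b≤a , (begin
  a                   ≤⟨ ℕP.m≤m+n a (4 ℕ.* a) ⟩
  5 ℕ.* a             ≡⟨ ℕP.m+n∸m≡n a (5 ℕ.* a) ⟨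
  6 ℕ.* a ∸ a         ≤⟨ ℕP.∸-monoʳ-≤ (6 ℕ.* a) b≤a ⟩
  6 ℕ.* a ∸ cℕ k      ∎)
  where
  open ℕP.≤-Reasoning
  a : ℕ
  a = cℕ (suc k)

c≡+cℕ : ∀ k → c k ≡ ℤ.+ cℕ k × c (suc k) ≡ ℤ.+ cℕ (suc k)
c≡+cℕ zero    = refl , refl
c≡+cℕ (suc k) with c≡+cℕ k
... | cₖ≡ , cₖ₊₁≡ = cₖ₊₁≡ , (begin
  ℤ.+ 6 ℤ.* c (suc k) ℤ.- c k    ≡⟨ cong₂ (λ x y → ℤ.+ 6 ℤ.* x ℤ.- y) cₖ₊₁≡ cₖ≡ ⟩
  ℤ.+ 6 ℤ.* ℤ.+ a ℤ.- ℤ.+ b      ≡⟨ cong (ℤ._- ℤ.+ b) (ℤP.pos-* 6 a) ⟨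
  ℤ.+ (6 ℕ.* a) ℤ.- ℤ.+ b        ≡⟨ ℤP.m-n≡m⊖n (6 ℕ.* a) b ⟩
  (6 ℕ.* a) ℤ.⊖ b                ≡⟨ ℤP.⊖-≥ b≤6a ⟩
  ℤ.+ (6 ℕ.* a ∸ b)              ∎)
  where
  open ≡-Reasoning
  a b : ℕ
  a = cℕ (suc k)
  b = cℕ k
  b≤6a : b ≤ 6 ℕ.* a
  b≤6a = ℕP.≤-trans (proj₂ (cℕ-positive-nondecreasing k)) (ℕP.m≤m+n a (5 ℕ.* a))

cℚ-nonNeg : ∀ k → NonNegative (cℚ k)
cℚ-nonNeg k rewrite proj₁ (c≡+cℕ k) = ℚP.normalize-nonNeg (cℕ k) 1

cℚ-pos : ∀ k → Positive (cℚ k)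
cℚ-pos k rewrite proj₁ (c≡+cℕ k) with cℕ k | proj₁ (cℕ-positive-nondecreasing k)
... | suc a | _ = ℚP.normalize-pos (suc a) 1

sumℕ-cℚ-nonNeg : ∀ k → NonNegative (sumℕ k cℚ)
sumℕ-cℚ-nonNeg zero    = _
sumℕ-cℚ-nonNeg (suc k) = ℚP.nonNeg+nonNeg⇒nonNeg (sumℕ k cℚ) {{sumℕ-cℚ-nonNeg k}} (cℚ k) {{cℚ-nonNeg k}}

sumℕ-cℚ-pos : ∀ k → Positive (sumℕ (suc k) cℚ)
sumℕ-cℚ-pos k = ℚP.nonNeg+pos⇒pos (sumℕ k cℚ) {{sumℕ-cℚ-nonNeg k}} (cℚ k) {{cℚ-pos k}}

reversed-c : ℕ → ℚ → ℕ → ℚ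
reversed-c L r j = cℚ (L ∸ j) * r

sumℕ-reversed-c : ∀ L r → sumℕ (suc L) (reversed-c L r) ≡ sumℕ (suc L) cℚ * r
sumℕ-reversed-c L r = trans (sumℕ-*ʳ (suc L) _ r) (cong (_* r) (sumℕ-reverse (suc L) cℚ))

record BackwardRecurrence (L : ℕ) (f : ℕ → ℚ) : Set where
  field
    top  : f L ≡ cℚ 1 * f (suc L)
    step : ∀ j → suc j ≤ L → f j ≡ 6ℚ * f (suc j) - f (2 ℕ.+ j)

backwardRecurrence⇒reversed-c : ∀ L f → BackwardRecurrence L f → ∀ j → j ≤ suc L → f j ≡ reversed-c (suc L) (f (suc L)) j
backwardRecurrence⇒reversed-c L f rec j j≤1+L with ℕP.m≤n⇒m<n∨m≡n j≤1+L
... | inj₂ refl rewrite ℕP.n∸n≡0 j = sym (ℚP.*-identityˡ (f j))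
... | inj₁ (s≤s j≤L) = begin
  f j                              ≡⟨ proj₁ (descend (L ∸ j) j (ℕP.m+[n∸m]≡n j≤L)) ⟩
  cℚ (suc (L ∸ j)) * f (suc L)     ≡⟨ cong (λ k → cℚ k * f (suc L)) (ℕP.+-∸-assoc 1 j≤L) ⟨
  cℚ (suc L ∸ j) * f (suc L)       ∎
  where
  open ≡-Reasoning
  open BackwardRecurrence rec
  t : ℚ
  t = f (suc L)
  descend : ∀ d j → j ℕ.+ d ≡ L → f j ≡ cℚ (suc d) * t × f (suc j) ≡ cℚ d * t
  descend zero j j+0≡L with trans (sym (ℕP.+-identityʳ j)) j+0≡L
  ... | refl = top , sym (ℚP.*-identityˡ t)
  descend (suc d) j j+1+d≡L with descend d (suc j) (trans (sym (ℕP.+-suc j d)) j+1+d≡L)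
  ... | fⱼ₊₁≡ , fⱼ₊₂≡ = fⱼ≡ , fⱼ₊₁≡
    where
    fⱼ≡ : f j ≡ cℚ (2 ℕ.+ d) * t
    fⱼ≡ = begin
      f j                                     ≡⟨ step j (subst (suc j ≤_) j+1+d≡L (ℕP.m<m+n j (s≤s z≤n))) ⟩
      6ℚ * f (suc j) - f (2 ℕ.+ j)            ≡⟨ cong₂ (λ x y → 6ℚ * x - y) fⱼ₊₁≡ fⱼ₊₂≡ ⟩
      6ℚ * (cℚ (suc d) * t) - cℚ d * t        ≡⟨ cℚ-rec-*ʳ d t ⟨
      cℚ (2 ℕ.+ d) * t                        ∎

reversed-c-backwardRecurrence : ∀ L r → BackwardRecurrence L (reversed-c (suc L) r)
reversed-c-backwardRecurrence L r = record { top = top ; step = step }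
  where
  top : cℚ (suc L ∸ L) * r ≡ cℚ 1 * (cℚ (L ∸ L) * r)
  top rewrite ℕP.m+n∸n≡m 1 L | ℕP.n∸n≡0 L = cong (cℚ 1 *_) (sym (ℚP.*-identityˡ r))
  step : ∀ j → suc j ≤ L → cℚ (suc L ∸ j) * r ≡ 6ℚ * (cℚ (L ∸ j) * r) - cℚ (L ∸ suc j) * r
  step j 1+j≤L
    rewrite ℕP.+-∸-assoc 1 (ℕP.<⇒≤ 1+j≤L) | ℕP.+-∸-assoc 1 1+j≤L = cℚ-rec-*ʳ (L ∸ suc j) r

column-interior⇔ : ∀ x a b → (x ≡ a * ⅙ + b * ⅙) ⇔ (a ≡ 6ℚ * x - b)
column-interior⇔ x a b = mk⇔ to from
  where
  open ≡-Reasoning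
  to : x ≡ a * ⅙ + b * ⅙ → a ≡ 6ℚ * x - b
  to x≡ = begin
    a                            ≡⟨ solve 2 (λ a b → a := con 6ℚ :* (a :* con ⅙ :+ b :* con ⅙) :- b) refl a b ⟩
    6ℚ * (a * ⅙ + b * ⅙) - b     ≡⟨ cong (λ z → 6ℚ * z - b) x≡ ⟨
    6ℚ * x - b                   ∎
  from : a ≡ 6ℚ * x - b → x ≡ a * ⅙ + b * ⅙
  from a≡ = begin
    x                            ≡⟨ solve 2 (λ x b → x := (con 6ℚ :* x :- b) :* con ⅙ :+ b :* con ⅙) refl x b ⟩
    (6ℚ * x - b) * ⅙ + b * ⅙     ≡⟨ cong (λ z → z * ⅙ + b * ⅙) a≡ ⟨
    a * ⅙ + b * ⅙                ∎

column-last⇔ : ∀ x y → (x ≡ y * ¹⁄₁₄ + x * ½) ⇔ (y ≡ cℚ 1 * x)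
column-last⇔ x y = mk⇔ to from
  where
  open ≡-Reasoning
  14ℚ : ℚ
  14ℚ = ℤ.+ 14 / 1
  to : x ≡ y * ¹⁄₁₄ + x * ½ → y ≡ cℚ 1 * x
  to x≡ = begin
    y                                    ≡⟨ solve 2 (λ x y → y := con 14ℚ :* (y :* con ¹⁄₁₄ :+ x :* con ½) :- con (cℚ 1) :* x)
                                              refl x y ⟩
    14ℚ * (y * ¹⁄₁₄ + x * ½) - cℚ 1 * x  ≡⟨ cong (λ z → 14ℚ * z - cℚ 1 * x) x≡ ⟨
    14ℚ * x - cℚ 1 * x                   ≡⟨ solve 1 (λ x → con 14ℚ :* x :- con (cℚ 1) :* x := con (cℚ 1) :* x) refl x ⟩
    cℚ 1 * x                             ∎
  from : y ≡ cℚ 1 * x → x ≡ y * ¹⁄₁₄ + x * ½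
  from y≡ = begin
    x                        ≡⟨ solve 1 (λ x → x := con (cℚ 1) :* x :* con ¹⁄₁₄ :+ x :* con ½) refl x ⟩
    cℚ 1 * x * ¹⁄₁₄ + x * ½  ≡⟨ cong (λ z → z * ¹⁄₁₄ + x * ½) y≡ ⟨
    y * ¹⁄₁₄ + x * ½         ∎

interior-columns⇔backwardRecurrence : ∀ m f →
  (∀ j → j ≤ 2 ℕ.+ m → f (suc j) ≡ vecMulP (4 ℕ.+ m) f (suc j)) ⇔ BackwardRecurrence (2 ℕ.+ m) f
interior-columns⇔backwardRecurrence m f = mk⇔ to from
  where
  to : (∀ j → j ≤ 2 ℕ.+ m → f (suc j) ≡ vecMulP (4 ℕ.+ m) f (suc j)) → BackwardRecurrence (2 ℕ.+ m) f
  to columns = record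
    { top  = Equivalence.to (column-last⇔ _ _) (trans (columns (2 ℕ.+ m) ℕP.≤-refl) (vecMulP-last m f))
    ; step = λ j 1+j≤2+m → Equivalence.to (column-interior⇔ _ _ _)
               (trans (columns j (ℕP.<⇒≤ 1+j≤2+m)) (vecMulP-interior m f j (ℕP.≤-pred 1+j≤2+m)))
    }
  from : BackwardRecurrence (2 ℕ.+ m) f → ∀ j → j ≤ 2 ℕ.+ m → f (suc j) ≡ vecMulP (4 ℕ.+ m) f (suc j)
  from rec j j≤2+m with ℕP.m≤n⇒m<n∨m≡n j≤2+m
  ... | inj₁ j<2+m = trans (Equivalence.from (column-interior⇔ _ _ _) (BackwardRecurrence.step rec j j<2+m))
                           (sym (vecMulP-interior m f j (ℕP.≤-pred j<2+m)))
  ... | inj₂ refl  = trans (Equivalence.from (column-last⇔ _ _) (BackwardRecurrence.top rec)) (sym (vecMulP-last m f))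

cℚ-column-zero : ∀ k →
  cℚ (suc k) ≡ sumℕ (2 ℕ.+ k) cℚ * ⅔ + ((cℚ (suc k) * ⅙ + cℚ k * ⅙) + (cℚ 1 * ²⁄₂₁ + cℚ 0 * -⅓))
cℚ-column-zero k = begin
  a                                        ≡⟨ solve 2 (λ a b → a := (con 6ℚ :* a :- b :- a :- con 2ℚ) :* con ⅙ :+ rest a b) refl a b ⟩
  (6ℚ * a - b - a - 2ℚ) * ⅙ + R            ≡⟨ cong (λ z → (z - a - 2ℚ) * ⅙ + R) (cℚ-rec k) ⟨
  (cℚ (2 ℕ.+ k) - a - 2ℚ) * ⅙ + R          ≡⟨ cong (λ z → z * ⅙ + R) (4*sumℕ-cℚ (suc k)) ⟨
  4ℚ * S * ⅙ + R                           ≡⟨ solve 3 (λ S a b → con 4ℚ :* S :* con ⅙ :+ rest a b := S :* con ⅔ :+ rest a b) refl S a b ⟩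
  S * ⅔ + R                                ∎
  where
  open ≡-Reasoning
  a b S R : ℚ
  a = cℚ (suc k)
  b = cℚ k
  S = sumℕ (2 ℕ.+ k) cℚ
  R = (a * ⅙ + b * ⅙) + (cℚ 1 * ²⁄₂₁ + cℚ 0 * -⅓)
  rest : ∀ {n} → Polynomial n → Polynomial n → Polynomial n
  rest a b = (a :* con ⅙ :+ b :* con ⅙) :+ (con (cℚ 1) :* con ²⁄₂₁ :+ con (cℚ 0) :* con -⅓)

reversed-c-column-zero : ∀ m r → reversed-c (3 ℕ.+ m) r 0 ≡ vecMulP (4 ℕ.+ m) (reversed-c (3 ℕ.+ m) r) 0
reversed-c-column-zero m r = begin
  a * r                                                      ≡⟨ cong (_* r) (cℚ-column-zero (2 ℕ.+ m)) ⟩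
  (S * ⅔ + ((a * ⅙ + b * ⅙) + (c₁ * ²⁄₂₁ + c₀ * -⅓))) * r
    ≡⟨ solve 6 (λ S a b c₁ c₀ r → (S :* con ⅔ :+ ((a :* con ⅙ :+ b :* con ⅙) :+ (c₁ :* con ²⁄₂₁ :+ c₀ :* con -⅓))) :* r
                := S :* r :* con ⅔ :+ ((a :* r :* con ⅙ :+ b :* r :* con ⅙) :+ (c₁ :* r :* con ²⁄₂₁ :+ c₀ :* r :* con -⅓)))
         refl S a b c₁ c₀ r ⟩
  S * r * ⅔ + ((a * r * ⅙ + b * r * ⅙) + (c₁ * r * ²⁄₂₁ + c₀ * r * -⅓))
    ≡⟨ cong₂ (λ x y → x * ⅔ + ((a * r * ⅙ + b * r * ⅙) + y))
             (sumℕ-reversed-c (3 ℕ.+ m) r) (cong₂ _+_ (cong (_* ²⁄₂₁) g[2+m]) (cong (_* -⅓) g[3+m])) ⟨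
  sumℕ n g * ⅔ + ((g 0 * ⅙ + g 1 * ⅙) + (g (2 ℕ.+ m) * ²⁄₂₁ + g (3 ℕ.+ m) * -⅓))
    ≡⟨ vecMulP-zero m g ⟨
  vecMulP n g 0                                              ∎
  where
  open ≡-Reasoning
  n : ℕ
  n = 4 ℕ.+ m
  g : ℕ → ℚ
  g = reversed-c (3 ℕ.+ m) r
  a b c₀ c₁ S : ℚ
  a  = cℚ (3 ℕ.+ m)
  b  = cℚ (2 ℕ.+ m)
  c₀ = cℚ 0
  c₁ = cℚ 1
  S  = sumℕ n cℚ
  g[2+m] : g (2 ℕ.+ m) ≡ c₁ * r
  g[2+m] = cong (λ k → cℚ k * r) (ℕP.m+n∸n≡m 1 m)
  g[3+m] : g (3 ℕ.+ m) ≡ c₀ * r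
  g[3+m] = cong (λ k → cℚ k * r) (ℕP.n∸n≡0 m)

-- Steady states

÷'-unique : ∀ x S t → S * t ≡ 1ℚ → x ÷' S ≡ x * t
÷'-unique x S t St≡1 with S ≟ 0ℚ
... | yes refl = case trans (sym (ℚP.*-zeroˡ t)) St≡1 of λ ()
... | no S≢0 = cong (x *_) (sym t≡1/S)
  where
  instance
    S-nonZero : ℚ.NonZero S
    S-nonZero = ≢-nonZero S≢0
  t≡1/S : t ≡ 1/ S
  t≡1/S = begin
    t                ≡⟨ ℚP.*-identityˡ t ⟨
    1ℚ * t           ≡⟨ cong (_* t) (ℚP.*-inverseˡ S) ⟨
    1/ S * S * t     ≡⟨ ℚP.*-assoc (1/ S) S t ⟩
    1/ S * (S * t)   ≡⟨ cong (1/ S *_) St≡1 ⟩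
    1/ S * 1ℚ        ≡⟨ ℚP.*-identityʳ (1/ S) ⟩
    1/ S             ∎
    where open ≡-Reasoning

steadyState⇒reversed-c : ∀ m (π : Fin (4 ℕ.+ m) → ℚ) → IsSteadyState (4 ℕ.+ m) (P (4 ℕ.+ m)) π →
                         ∀ i → π i ≡ cℚ (3 ℕ.+ m ∸ toℕ i) ÷' sumℕ (4 ℕ.+ m) cℚ
steadyState⇒reversed-c m π steady i = begin
  π i                          ≡⟨ extend-toℕ n π i ⟩
  f (toℕ i)                    ≡⟨ shape (toℕ i) (ℕP.≤-pred (toℕ<n i)) ⟩
  cℚ (3 ℕ.+ m ∸ toℕ i) * t     ≡⟨ ÷'-unique (cℚ (3 ℕ.+ m ∸ toℕ i)) S t normalised ⟨
  cℚ (3 ℕ.+ m ∸ toℕ i) ÷' S    ∎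
  where
  open ≡-Reasoning
  open IsSteadyState steady
  n : ℕ
  n = 4 ℕ.+ m
  f : ℕ → ℚ
  f = extend n π
  S t : ℚ
  S = sumℕ n cℚ
  t = f (3 ℕ.+ m)
  column : ∀ j → j < n → f j ≡ vecMulP n f j
  column j j<n = begin
    f j                                        ≡⟨ extend-fromℕ< n π j j<n ⟩
    π (fromℕ< j<n)                             ≡⟨ stationary (fromℕ< j<n) ⟩
    sumFin n (λ i → π i * P n i (fromℕ< j<n))  ≡⟨ sumFin-*P≡vecMulP n π f (extend-toℕ n π) (fromℕ< j<n) ⟩
    vecMulP n f (toℕ (fromℕ< j<n))             ≡⟨ cong (vecMulP n f) (toℕ-fromℕ< j<n) ⟩
    vecMulP n f j                              ∎
  shape : ∀ j → j ≤ 3 ℕ.+ m → f j ≡ reversed-c (3 ℕ.+ m) t j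
  shape = backwardRecurrence⇒reversed-c (2 ℕ.+ m) f
    (Equivalence.to (interior-columns⇔backwardRecurrence m f) (λ j j≤2+m → column (suc j) (s≤s (s≤s j≤2+m))))
  normalised : S * t ≡ 1ℚ
  normalised = begin
    S * t                            ≡⟨ sumℕ-reversed-c (3 ℕ.+ m) t ⟨
    sumℕ n (reversed-c (3 ℕ.+ m) t)  ≡⟨ sumℕ-cong n (λ j j<n → shape j (ℕP.≤-pred j<n)) ⟨
    sumℕ n f                         ≡⟨ sumFin-toℕ n f ⟨
    sumFin n (λ i → f (toℕ i))       ≡⟨ sumFin-cong n (extend-toℕ n π) ⟨
    sumFin n π                       ≡⟨ sums-to-1 ⟩
    1ℚ                               ∎

reversed-c⇒steadyState : ∀ m (π : Fin (4 ℕ.+ m) → ℚ) →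
                         (∀ i → π i ≡ cℚ (3 ℕ.+ m ∸ toℕ i) ÷' sumℕ (4 ℕ.+ m) cℚ) →
                         IsSteadyState (4 ℕ.+ m) (P (4 ℕ.+ m)) π
reversed-c⇒steadyState m π π≡ = record
  { nonneg     = λ i → subst (0ℚ ℚ.≤_) (sym (π≡g i)) (ℚP.nonNegative⁻¹ (g (toℕ i)) {{g-nonNeg (toℕ i)}})
  ; sums-to-1  = begin
      sumFin n π                   ≡⟨ sumFin-cong n π≡g ⟩
      sumFin n (λ i → g (toℕ i))   ≡⟨ sumFin-toℕ n g ⟩
      sumℕ n g                     ≡⟨ sumℕ-reversed-c (3 ℕ.+ m) r ⟩
      S * r                        ≡⟨ ℚP.*-inverseʳ S ⟩
      1ℚ                           ∎
  ; stationary = λ j → trans (π≡g j) (trans (columns (toℕ j) (toℕ<n j)) (sym (sumFin-*P≡vecMulP n π g π≡g j)))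
  }
  where
  open ≡-Reasoning
  n : ℕ
  n = 4 ℕ.+ m
  S : ℚ
  S = sumℕ n cℚ
  instance
    S-pos : Positive S
    S-pos = sumℕ-cℚ-pos (3 ℕ.+ m)
    S-nonZero : ℚ.NonZero S
    S-nonZero = ℚP.pos⇒nonZero S
  r : ℚ
  r = 1/ S
  g : ℕ → ℚ
  g = reversed-c (3 ℕ.+ m) r
  g-nonNeg : ∀ j → NonNegative (g j)
  g-nonNeg j =
    ℚP.nonNeg*nonNeg⇒nonNeg (cℚ (3 ℕ.+ m ∸ j)) {{cℚ-nonNeg (3 ℕ.+ m ∸ j)}} r {{ℚP.pos⇒nonNeg r {{ℚP.1/pos⇒pos S}}}}
  π≡g : ∀ i → π i ≡ g (toℕ i)
  π≡g i = trans (π≡ i) (÷'-unique _ S r (ℚP.*-inverseʳ S))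
  columns : ∀ j → j < n → g j ≡ vecMulP n g j
  columns zero    _                 = reversed-c-column-zero m r
  columns (suc j) (s≤s (s≤s j≤2+m)) =
    Equivalence.from (interior-columns⇔backwardRecurrence m g) (reversed-c-backwardRecurrence (2 ℕ.+ m) r) j j≤2+m

theorem3p3 : (n : ℕ) → 4 ≤ n → (π : Fin n → ℚ) →
    IsSteadyState n (P n) π ⇔ (∀ i → π i ≡ cℚ (n ∸ 1 ∸ toℕ i) ÷' sumℕ n cℚ)
theorem3p3 (suc (suc (suc (suc m)))) (s≤s (s≤s (s≤s (s≤s z≤n)))) π =
  mk⇔ (steadyState⇒reversed-c m π) (reversed-c⇒steadyState m π)
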